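{- There is a constant $c$ such that for every $\mathrm{FO}(<,\mathrm{succ},\mathrm{min},\mathrm{max})$-sentence $\varphi$ there is an $\mathrm{FO}^2(<)$-sentence $\psi$ of size $|\psi|\le 2^{c\cdot|\varphi|}$ such that for all $N\in\mathbb{N}$: $\mathcal{A}_N\models\psi$ iff $\mathcal{A}_N\models\varphi$.
   Context: For $N\in\mathbb{N}$, $\mathcal{A}_N$ is the structure with universe $\{0,\dots,N\}$, $<$ the natural linear order, $\mathrm{succ}=\{(a,a+1):0\le a<N\}$, constants $\mathrm{min}=0$ and $\mathrm{max}=N$; the class of linear orders is $\{\mathcal{A}_N:N\in\mathbb{N}\}$. $\mathrm{FO}(<,\mathrm{succ},\mathrm{min},\mathrm{max})$ is first-order logic over this signature; $\mathrm{FO}^2(<)$ is the fragment of first-order logic over $\{<\}$ using only two distinct variables. The size of a formula is the number of nodes of its syntax tree. -}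

module Defs where

open import Data.Nat using (ℕ; zero; suc; _+_; _≤_; _<_)
open import Data.Fin using (Fin)
open import Data.Product using (Σ; _×_; _,_)
open import Data.Sum using (_⊎_)
open import Data.Empty using (⊥)
open import Relation.Nullary using (¬_)
open import Relation.Binary.PropositionalEquality using (_≡_; _≢_)
open import Data.List using (List; []; _∷_; _++_; filter)
open import Data.List.Relation.Unary.All using (All)
open import Data.Nat using (_≟_)

-- Structures A_N : universe {0,…,N}, elements represented as naturals ≤ N.
-- succ(a,b) holds iff b = a + 1 (with a < N, automatic since b ≤ N).

data Term : Set where
  var : ℕ → Term
  cmin : Term
  cmax : Term

data FO : Set where
  _≐_   : Term → Term → FO
  _≺_   : Term → Term → FO
  succ  : Term → Term → FO
  ¬'_   : FO → FO
  _∧'_  : FO → FO → FO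
  _∨'_  : FO → FO → FO
  ∃'    : ℕ → FO → FO
  ∀'    : ℕ → FO → FO

termVars : Term → List ℕ
termVars (var x) = x ∷ []
termVars cmin = []
termVars cmax = []

remove : ℕ → List ℕ → List ℕ
remove x [] = []
remove x (y ∷ ys) with x ≟ y
... | Relation.Nullary.yes _ = remove x ys
... | Relation.Nullary.no _ = y ∷ remove x ys

free : FO → List ℕ
free (s ≐ t) = termVars s ++ termVars t
free (s ≺ t) = termVars s ++ termVars t
free (succ s t) = termVars s ++ termVars t
free (¬' φ) = free φ
free (φ ∧' ψ) = free φ ++ free ψ
free (φ ∨' ψ) = free φ ++ free ψ
free (∃' x φ) = remove x (free φ)
free (∀' x φ) = remove x (free φ)

IsSentence : FO → Set
IsSentence φ = free φ ≡ []

termSize : Term → ℕ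
termSize _ = 1

size : FO → ℕ
size (s ≐ t) = suc (termSize s + termSize t)
size (s ≺ t) = suc (termSize s + termSize t)
size (succ s t) = suc (termSize s + termSize t)
size (¬' φ) = suc (size φ)
size (φ ∧' ψ) = suc (size φ + size ψ)
size (φ ∨' ψ) = suc (size φ + size ψ)
size (∃' x φ) = suc (size φ)
size (∀' x φ) = suc (size φ)

update : (ℕ → ℕ) → ℕ → ℕ → (ℕ → ℕ)
update ρ x a y with x ≟ y
... | Relation.Nullary.yes _ = a
... | Relation.Nullary.no _ = ρ y

evalT : ℕ → (ℕ → ℕ) → Term → ℕ
evalT N ρ (var x) = ρ x
evalT N ρ cmin = 0
evalT N ρ cmax = N

Sat : ℕ → (ℕ → ℕ) → FO → Set
Sat N ρ (s ≐ t) = evalT N ρ s ≡ evalT N ρ t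
Sat N ρ (s ≺ t) = evalT N ρ s < evalT N ρ t
Sat N ρ (succ s t) = suc (evalT N ρ s) ≡ evalT N ρ t
Sat N ρ (¬' φ) = ¬ Sat N ρ φ
Sat N ρ (φ ∧' ψ) = Sat N ρ φ × Sat N ρ ψ
Sat N ρ (φ ∨' ψ) = Sat N ρ φ ⊎ Sat N ρ ψ
Sat N ρ (∃' x φ) = Σ ℕ λ a → a ≤ N × Sat N (update ρ x a) φ
Sat N ρ (∀' x φ) = (a : ℕ) → a ≤ N → Sat N (update ρ x a) φ

-- A_N ⊨ φ for a sentence: evaluate under the assignment sending every
-- variable to 0 (irrelevant for sentences; 0 ∈ A_N).
_⊨_ : ℕ → FO → Set
N ⊨ φ = Sat N (λ _ → 0) φ

data FO2 : Set where
  _≐_  : Fin 2 → Fin 2 → FO2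
  _≺_  : Fin 2 → Fin 2 → FO2
  ¬'_  : FO2 → FO2
  _∧'_ : FO2 → FO2 → FO2
  _∨'_ : FO2 → FO2 → FO2
  ∃'   : Fin 2 → FO2 → FO2
  ∀'   : Fin 2 → FO2 → FO2

removeF : Fin 2 → List (Fin 2) → List (Fin 2)
removeF x [] = []
removeF x (y ∷ ys) with x Data.Fin.≟ y
... | Relation.Nullary.yes _ = removeF x ys
... | Relation.Nullary.no _ = y ∷ removeF x ys

free2 : FO2 → List (Fin 2)
free2 (x ≐ y) = x ∷ y ∷ []
free2 (x ≺ y) = x ∷ y ∷ []
free2 (¬' φ) = free2 φ
free2 (φ ∧' ψ) = free2 φ ++ free2 ψ
free2 (φ ∨' ψ) = free2 φ ++ free2 ψ
free2 (∃' x φ) = removeF x (free2 φ)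
free2 (∀' x φ) = removeF x (free2 φ)

IsSentence2 : FO2 → Set
IsSentence2 ψ = free2 ψ ≡ []

size2 : FO2 → ℕ
size2 (x ≐ y) = 3
size2 (x ≺ y) = 3
size2 (¬' φ) = suc (size2 φ)
size2 (φ ∧' ψ) = suc (size2 φ + size2 ψ)
size2 (φ ∨' ψ) = suc (size2 φ + size2 ψ)
size2 (∃' x φ) = suc (size2 φ)
size2 (∀' x φ) = suc (size2 φ)

update2 : (Fin 2 → ℕ) → Fin 2 → ℕ → (Fin 2 → ℕ)
update2 ρ x a y with x Data.Fin.≟ y
... | Relation.Nullary.yes _ = a
... | Relation.Nullary.no _ = ρ y

Sat2 : ℕ → (Fin 2 → ℕ) → FO2 → Set
Sat2 N ρ (x ≐ y) = ρ x ≡ ρ y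
Sat2 N ρ (x ≺ y) = ρ x < ρ y
Sat2 N ρ (¬' φ) = ¬ Sat2 N ρ φ
Sat2 N ρ (φ ∧' ψ) = Sat2 N ρ φ × Sat2 N ρ ψ
Sat2 N ρ (φ ∨' ψ) = Sat2 N ρ φ ⊎ Sat2 N ρ ψ
Sat2 N ρ (∃' x φ) = Σ ℕ λ a → a ≤ N × Sat2 N (update2 ρ x a) φ
Sat2 N ρ (∀' x φ) = (a : ℕ) → a ≤ N → Sat2 N (update2 ρ x a) φ

_⊨₂_ : ℕ → FO2 → Set
N ⊨₂ ψ = Sat2 N (λ _ → 0) ψ

-- Two distances agree at threshold t when they are equal or both at least
-- t.  Suppose all pairwise distances between the points pebbled in A_N
-- agree at 2t with the distances between their partners in A_M.  Then a
-- new point a of A_N has a partner b in A_M keeping all distances in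
-- agreement at t: b cuts the gap between the partners of the nearest
-- pebbled neighbours of a as a cuts the gap between those neighbours,
-- which is possible because a gap agreeing at 2t splits into two pieces
-- agreeing at t.  Halving the threshold at each quantifier, starting from
-- the pebbled endpoints min and max, A_N and A_M satisfy the same φ once
-- N, M ≥ T = 2^|φ|.  So the set of N with A_N ⊨ φ is decidable and
-- constant from T on, and is defined by the FO²(<) disjunction of "N = k"
-- over the k < T in it and "N ≥ T" if T is in it.  With two variables,
-- "N ≥ k" has size O(k): a descending chain x > y > x > ⋯ of length k
-- that requantifies the two variables alternately.

module Submission where

open import Defs
open import Data.Nat using (ℕ; _≤_; _^_; _*_)
open import Data.Product using (Σ; _×_)
open import Function.Bundles using (_⇔_)

open import Data.Nat using (zero; suc; _+_; _∸_; _<_; z≤n; s≤s; s≤s⁻¹; _≟_; _≤?_)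
open import Data.Nat.Properties
open import Data.Nat.Tactic.RingSolver using (solve-∀)
open import Data.Fin using (Fin) renaming (zero to #0; suc to fsuc)
open import Data.Product using (_,_; proj₁; proj₂)
open import Data.Sum using (_⊎_; inj₁; inj₂)
open import Data.Empty using (⊥-elim)
open import Data.List using (List; []; _∷_; _++_; filter)
open import Data.List.Membership.Propositional using (_∈_)
open import Data.List.Membership.Propositional.Properties using (∈-filter⁺; ∈-filter⁻)
open import Data.List.Relation.Unary.Any using (here; there)
open import Data.List.Relation.Unary.All using (lookup)
open import Data.List.Relation.Binary.Subset.Propositional using (_⊆_)
open import Data.List.Relation.Binary.Subset.Propositional.Properties
  using (∷⁺ʳ; xs⊆xs++ys; xs⊆ys++xs)
open import Data.List.Extrema ≤-totalOrder
  using (argmax; argmin; argmax-sel; argmin-sel; f[xs]≤f[argmax]; f[argmin]≤f[xs])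
open import Function.Base using (_∘_)
open import Function.Bundles using (mk⇔; module Equivalence)
open import Relation.Nullary using (Dec; yes; no)
open import Relation.Nullary.Decidable using (¬?; _×-dec_; _⊎-dec_)
open import Relation.Unary using (Decidable)
open import Relation.Binary.PropositionalEquality

open Equivalence using (to; from)

private variable
  I : Set
  α β α' β' : I → ℕ
  Is Js : List I
  t t' a k : ℕ

infix 4 _≈[_]_

_≈[_]_ : ℕ → ℕ → ℕ → Set
x ≈[ t ] y = x ≡ y ⊎ (t ≤ x × t ≤ y)

≈-refl : ∀ {x} → x ≈[ t ] x
≈-refl = inj₁ refl

≈-sym : ∀ {x y} → x ≈[ t ] y → y ≈[ t ] x
≈-sym (inj₁ x≡y)         = inj₁ (sym x≡y)
≈-sym (inj₂ (t≤x , t≤y)) = inj₂ (t≤y , t≤x)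

≈-weaken : ∀ {x y} → t' ≤ t → x ≈[ t ] y → x ≈[ t' ] y
≈-weaken _    (inj₁ x≡y)         = inj₁ x≡y
≈-weaken t'≤t (inj₂ (t≤x , t≤y)) = inj₂ (≤-trans t'≤t t≤x , ≤-trans t'≤t t≤y)

+-cong-≈ : ∀ {x x' y y'} → x ≈[ t ] x' → y ≈[ t ] y' → x + y ≈[ t ] x' + y'
+-cong-≈ (inj₁ refl) (inj₁ refl) = inj₁ refl
+-cong-≈ {x = x} {x'} {y} {y'} (inj₂ (t≤x , t≤x')) _ =
  inj₂ (≤-trans t≤x (m≤m+n x y) , ≤-trans t≤x' (m≤m+n x' y'))
+-cong-≈ {x = x} {x'} {y} {y'} (inj₁ _) (inj₂ (t≤y , t≤y')) =
  inj₂ (≤-trans t≤y (m≤n+m y x) , ≤-trans t≤y' (m≤n+m y' x'))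

≈-below : ∀ {x y} → k < t → x ≈[ t ] y → x ≡ k → y ≡ k
≈-below _   (inj₁ refl)       x≡k  = x≡k
≈-below k<t (inj₂ (t≤x , _)) refl = ⊥-elim (<⇒≱ k<t t≤x)

∸≡0-≈ : ∀ {x y x' y'} → x ≤ y → x' ≤ y' → x ∸ y ≈[ t ] x' ∸ y'
∸≡0-≈ x≤y x'≤y' = inj₁ (trans (m≤n⇒m∸n≡0 x≤y) (sym (m≤n⇒m∸n≡0 x'≤y')))

m≤o∸n : ∀ {m n o} → n ≤ m → m + m ≤ o → m ≤ o ∸ n
m≤o∸n {m} n≤m 2m≤o = ≤-trans (≤-reflexive (sym (m+n∸n≡m m m))) (∸-mono 2m≤o n≤m)

≈-split : ∀ {u v d} → u + v ≈[ t + t ] d →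
          Σ ℕ λ w → w ≤ d × u ≈[ t ] w × v ≈[ t ] d ∸ w
≈-split {u = u} {v} (inj₁ refl) = u , m≤m+n u v , ≈-refl , inj₁ (sym (m+n∸m≡n u v))
≈-split {t} {u} {v} {d} (inj₂ (2t≤u+v , 2t≤d)) with t ≤? u | t ≤? v
... | no t≰u | _ = u , ≤-trans u≤t (≤-trans (m≤m+n t t) 2t≤d) , ≈-refl ,
                   inj₂ (t≤v , m≤o∸n u≤t 2t≤d)
  where
  u≤t = <⇒≤ (≰⇒> t≰u)
  t≤v = +-cancelˡ-≤ u t v (≤-trans (+-monoˡ-≤ t u≤t) 2t≤u+v)
... | yes t≤u | yes t≤v = t , ≤-trans (m≤m+n t t) 2t≤d , inj₂ (t≤u , ≤-refl) ,
                          inj₂ (t≤v , m≤o∸n ≤-refl 2t≤d)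
... | yes t≤u | no t≰v = d ∸ v , m∸n≤m d v , inj₂ (t≤u , m≤o∸n v≤t 2t≤d) ,
                         inj₁ (sym (m∸[m∸n]≡n (≤-trans v≤t (≤-trans (m≤m+n t t) 2t≤d))))
  where
  v≤t = <⇒≤ (≰⇒> t≰v)

∸-split : ∀ {x y z} → x ≤ y → y ≤ z → (y ∸ x) + (z ∸ y) ≡ z ∸ x
∸-split {x} {y} {z} x≤y y≤z = begin
  (y ∸ x) + (z ∸ y) ≡⟨ +-comm (y ∸ x) (z ∸ y) ⟩
  (z ∸ y) + (y ∸ x) ≡⟨ sym (+-∸-assoc (z ∸ y) x≤y) ⟩
  (z ∸ y + y) ∸ x   ≡⟨ cong (_∸ x) (m∸n+n≡m y≤z) ⟩
  z ∸ x             ∎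
  where open ≡-Reasoning

≈-glue : ∀ {x y z x' y' z'} → x ≤ y → y ≤ z → x' ≤ y' → y' ≤ z' →
         y ∸ x ≈[ t ] y' ∸ x' → z ∸ y ≈[ t ] z' ∸ y' → z ∸ x ≈[ t ] z' ∸ x'
≈-glue {t = t} x≤y y≤z x'≤y' y'≤z' e f =
  subst₂ (_≈[ t ]_) (∸-split x≤y y≤z) (∸-split x'≤y' y'≤z') (+-cong-≈ e f)

≤-transfer : ∀ {x y x' y'} → 0 < t → x ≤ y → x ∸ y ≈[ t ] x' ∸ y' → x' ≤ y'
≤-transfer 0<t x≤y e = m∸n≡0⇒m≤n (≈-below 0<t e (m≤n⇒m∸n≡0 x≤y))

<-transfer : ∀ {x y x' y'} → 0 < t → x < y → y ∸ x ≈[ t ] y' ∸ x' → x' < y'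
<-transfer 0<t x<y e = ≰⇒> (λ y'≤x' → <⇒≱ x<y (≤-transfer 0<t y'≤x' (≈-sym e)))

suc-transfer : ∀ {x y x' y'} → 1 < t → suc x ≡ y → y ∸ x ≈[ t ] y' ∸ x' → suc x' ≡ y'
suc-transfer {x = x} {x' = x'} {y'} 1<t refl e = begin
  suc x'         ≡⟨ +-comm 1 x' ⟩
  x' + 1         ≡⟨ cong (x' +_) (sym gap≡1) ⟩
  x' + (y' ∸ x') ≡⟨ m+[n∸m]≡n (<⇒≤ (<-transfer {x' = x'} {y'} (<⇒≤ 1<t) (n<1+n x) e)) ⟩
  y'             ∎
  where
  open ≡-Reasoning
  gap≡1 : y' ∸ x' ≡ 1
  gap≡1 = ≈-below 1<t e (m+n∸n≡m 1 x)

-- Positions of the Ehrenfeucht–Fraïssé game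

record Similar (α β : I → ℕ) (t : ℕ) (Is : List I) : Set where
  field gap : ∀ {i j} → i ∈ Is → j ∈ Is → α j ∸ α i ≈[ t ] β j ∸ β i

record Matches (α β : I → ℕ) (t : ℕ) (Is : List I) (a b : ℕ) : Set where
  field newGaps : ∀ {i} → i ∈ Is → (a ∸ α i ≈[ t ] b ∸ β i) × (α i ∸ a ≈[ t ] β i ∸ b)

open Similar
open Matches

Similar-sym : Similar α β t Is → Similar β α t Is
Similar-sym S .gap i∈ j∈ = ≈-sym (S .gap i∈ j∈)

Similar-weaken : t' ≤ t → Similar α β t Is → Similar α β t' Is
Similar-weaken t'≤t S .gap i∈ j∈ = ≈-weaken t'≤t (S .gap i∈ j∈)

Similar-⊆ : Is ⊆ Js → Similar α β t Js → Similar α β t Is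
Similar-⊆ Is⊆Js S .gap i∈ j∈ = S .gap (Is⊆Js i∈) (Is⊆Js j∈)

Matches-sym : ∀ {b} → Matches α β t Is a b → Matches β α t Is b a
Matches-sym M .newGaps i∈ = ≈-sym (proj₁ (M .newGaps i∈)) , ≈-sym (proj₂ (M .newGaps i∈))

Similar-update : ∀ {b} → Similar α β (t + t) Is → Matches α β t Is a b →
                 (∀ {i} → i ∈ Is → (α' i ≡ a × β' i ≡ b) ⊎ (α' i ≡ α i × β' i ≡ β i)) →
                 Similar α' β' t Is
Similar-update {t = t} {a = a} {b = b} S M new-or-old .gap {i} {j} i∈ j∈
  with new-or-old i∈ | new-or-old j∈
... | inj₁ (p , q) | inj₁ (p' , q') rewrite p | q | p' | q' = ∸≡0-≈ (≤-refl {a}) (≤-refl {b})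
... | inj₁ (p , q) | inj₂ (p' , q') rewrite p | q | p' | q' = proj₂ (M .newGaps j∈)
... | inj₂ (p , q) | inj₁ (p' , q') rewrite p | q | p' | q' = proj₁ (M .newGaps i∈)
... | inj₂ (p , q) | inj₂ (p' , q') rewrite p | q | p' | q' = ≈-weaken (m≤n+m t t) (S .gap i∈ j∈)

module _ (α : I → ℕ) (a : ℕ) {lo : I} {Is : List I} (lo∈ : lo ∈ Is) where

  closestBelow : α lo ≤ a →
    Σ I λ l → l ∈ Is × α l ≤ a × (∀ {i} → i ∈ Is → α i ≤ a → α i ≤ α l)
  closestBelow lo≤a = l , proj₁ selected , proj₂ selected ,
    λ i∈ i≤a → lookup (f[xs]≤f[argmax] lo candidates) (∈-filter⁺ _ i∈ i≤a)
    where
    candidates = filter (λ i → α i ≤? a) Is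
    l  = argmax α lo candidates
    selected : l ∈ Is × α l ≤ a
    selected with argmax-sel α lo candidates
    ... | inj₁ l≡lo rewrite l≡lo = lo∈ , lo≤a
    ... | inj₂ l∈candidates = ∈-filter⁻ _ l∈candidates

  closestAbove : a ≤ α lo →
    Σ I λ r → r ∈ Is × a ≤ α r × (∀ {i} → i ∈ Is → a ≤ α i → α r ≤ α i)
  closestAbove a≤lo = r , proj₁ selected , proj₂ selected ,
    λ i∈ a≤i → lookup (f[argmin]≤f[xs] lo candidates) (∈-filter⁺ _ i∈ a≤i)
    where
    candidates = filter (λ i → a ≤? α i) Is
    r  = argmin α lo candidates
    selected : r ∈ Is × a ≤ α r
    selected with argmin-sel α lo candidates
    ... | inj₁ r≡lo rewrite r≡lo = lo∈ , a≤lo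
    ... | inj₂ r∈candidates = ∈-filter⁻ _ r∈candidates

extend-between : ∀ {l r} → 0 < t → Similar α β (t + t) Is → l ∈ Is → r ∈ Is →
  α l ≤ a → a ≤ α r →
  (∀ {i} → i ∈ Is → α i ≤ a → α i ≤ α l) → (∀ {i} → i ∈ Is → a ≤ α i → α r ≤ α i) →
  Σ ℕ λ b → b ≤ β r × Matches α β t Is a b
extend-between {t = t} {α = α} {β = β} {Is = Is} {a = a} {l = l} {r = r}
               0<t S l∈ r∈ l≤a a≤r l-greatest r-least
  with ≈-split (subst (_≈[ t + t ] β r ∸ β l) (sym (∸-split l≤a a≤r)) (S .gap l∈ r∈))
... | w , w≤gap , left₀ , right₀ = b , b≤βr , matches
  where
  0<2t = ≤-trans 0<t (m≤m+n t t)
  t≤2t = m≤n+m t t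
  b = β l + w

  βl≤βr : β l ≤ β r
  βl≤βr = ≤-transfer 0<2t (≤-trans l≤a a≤r) (S .gap r∈ l∈)

  βl≤b : β l ≤ b
  βl≤b = m≤m+n (β l) w

  b≤βr : b ≤ β r
  b≤βr = ≤-trans (+-monoʳ-≤ (β l) w≤gap) (≤-reflexive (m+[n∸m]≡n βl≤βr))

  left : a ∸ α l ≈[ t ] b ∸ β l
  left = subst (_ ≈[ t ]_) (sym (m+n∸m≡n (β l) w)) left₀

  right : α r ∸ a ≈[ t ] β r ∸ b
  right = subst (α r ∸ a ≈[ t ]_) (∸-+-assoc (β r) (β l) w) right₀

  matches : Matches α β t Is a b
  matches .newGaps {i} i∈ with α i ≤? a
  ... | yes i≤a = ≈-glue αi≤αl l≤a βi≤βl βl≤b (≈-weaken t≤2t (S .gap i∈ l∈)) left ,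
                  ∸≡0-≈ i≤a (≤-trans βi≤βl βl≤b)
    where
    αi≤αl = l-greatest i∈ i≤a
    βi≤βl = ≤-transfer 0<2t αi≤αl (S .gap l∈ i∈)
  ... | no i≰a = ∸≡0-≈ a≤i (≤-trans b≤βr βr≤βi) ,
                 ≈-glue a≤r αr≤αi b≤βr βr≤βi right (≈-weaken t≤2t (S .gap r∈ i∈))
    where
    a≤i = <⇒≤ (≰⇒> i≰a)
    αr≤αi = r-least i∈ a≤i
    βr≤βi = ≤-transfer 0<2t αr≤αi (S .gap i∈ r∈)

extend : ∀ {lo hi} → 0 < t → Similar α β (t + t) Is → lo ∈ Is → hi ∈ Is →
         α lo ≤ a → a ≤ α hi → Σ ℕ λ b → b ≤ β hi × Matches α β t Is a b
extend {t = t} {α = α} {β = β} {a = a} {hi = hi} 0<t S lo∈ hi∈ lo≤a a≤hi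
  with closestBelow α a lo∈ lo≤a | closestAbove α a hi∈ a≤hi
... | l , l∈ , l≤a , l-greatest | r , r∈ , a≤r , r-least
  with extend-between 0<t S l∈ r∈ l≤a a≤r l-greatest r-least
... | b , b≤βr , matches = b , ≤-trans b≤βr βr≤βhi , matches
  where
  βr≤βhi : β r ≤ β hi
  βr≤βhi = ≤-transfer (≤-trans 0<t (m≤m+n t t)) (r-least hi∈ a≤hi) (S .gap hi∈ r∈)

-- Transfer of formulas between similar positions

termsOf : FO → List Term
termsOf (s ≐ u)    = s ∷ u ∷ []
termsOf (s ≺ u)    = s ∷ u ∷ []
termsOf (succ s u) = s ∷ u ∷ []
termsOf (¬' φ)     = termsOf φ
termsOf (φ ∧' ψ)   = termsOf φ ++ termsOf ψ
termsOf (φ ∨' ψ)   = termsOf φ ++ termsOf ψ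
termsOf (∃' x φ)   = termsOf φ
termsOf (∀' x φ)   = termsOf φ

terms : FO → List Term
terms φ = cmin ∷ cmax ∷ termsOf φ

pattern cmin∈ = here refl
pattern cmax∈ = there (here refl)
pattern lhs∈  = there (there (here refl))
pattern rhs∈  = there (there (there (here refl)))

Similar-sub : ∀ φ ψ → size φ ≤ size ψ → termsOf φ ⊆ termsOf ψ →
  Similar α β (2 ^ size ψ) (terms ψ) → Similar α β (2 ^ size φ) (terms φ)
Similar-sub _ _ size≤ ⊆ψ S =
  Similar-⊆ (∷⁺ʳ cmin (∷⁺ʳ cmax ⊆ψ)) (Similar-weaken (^-monoʳ-≤ 2 size≤) S)

Similar-halve : ∀ n → Similar α β (2 ^ suc n) Is → Similar α β (2 ^ n + 2 ^ n) Is
Similar-halve n = Similar-weaken (≤-reflexive (cong (2 ^ n +_) (sym (*-identityˡ (2 ^ n)))))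

evalT-update : ∀ {N M ρ σ v a b} s →
  (evalT N (update ρ v a) s ≡ a × evalT M (update σ v b) s ≡ b) ⊎
  (evalT N (update ρ v a) s ≡ evalT N ρ s × evalT M (update σ v b) s ≡ evalT M σ s)
evalT-update {v = v} (var y) with v ≟ y
... | yes _ = inj₁ (refl , refl)
... | no _  = inj₂ (refl , refl)
evalT-update cmin = inj₂ (refl , refl)
evalT-update cmax = inj₂ (refl , refl)

Similar-assign : ∀ {N M ρ σ v a b} →
  Similar (evalT N ρ) (evalT M σ) (t + t) Is → Matches (evalT N ρ) (evalT M σ) t Is a b →
  Similar (evalT N (update ρ v a)) (evalT M (update σ v b)) t Is
Similar-assign {N = N} {M} {ρ} {σ} {v} {a} {b} S m =
  Similar-update S m (λ {i} _ → evalT-update {N} {M} {ρ} {σ} {v} {a} {b} i)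

transfer : ∀ φ {N M ρ σ} → Similar (evalT N ρ) (evalT M σ) (2 ^ size φ) (terms φ) →
           Sat N ρ φ → Sat M σ φ
transfer (s ≐ u) S s≡u =
  ≤-antisym (≤-transfer (s≤s z≤n) (≤-reflexive s≡u) (S .gap rhs∈ lhs∈))
            (≤-transfer (s≤s z≤n) (≤-reflexive (sym s≡u)) (S .gap lhs∈ rhs∈))
transfer (s ≺ u) S s<u = <-transfer (s≤s z≤n) s<u (S .gap lhs∈ rhs∈)
transfer (succ s u) S 1+s≡u = suc-transfer (s≤s (s≤s z≤n)) 1+s≡u (S .gap lhs∈ rhs∈)
transfer (¬' φ) S ¬φ φ′ =
  ¬φ (transfer φ (Similar-sub φ (¬' φ) (n≤1+n _) (λ i∈ → i∈) (Similar-sym S)) φ′)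
transfer (φ ∧' ψ) S (hφ , hψ) =
  transfer φ (Similar-sub φ (φ ∧' ψ) (≤-trans (m≤m+n _ _) (n≤1+n _)) (xs⊆xs++ys _ _) S) hφ ,
  transfer ψ (Similar-sub ψ (φ ∧' ψ) (≤-trans (m≤n+m _ _) (n≤1+n _)) (xs⊆ys++xs _ _) S) hψ
transfer (φ ∨' ψ) S (inj₁ hφ) =
  inj₁ (transfer φ (Similar-sub φ (φ ∨' ψ) (≤-trans (m≤m+n _ _) (n≤1+n _)) (xs⊆xs++ys _ _) S) hφ)
transfer (φ ∨' ψ) S (inj₂ hψ) =
  inj₂ (transfer ψ (Similar-sub ψ (φ ∨' ψ) (≤-trans (m≤n+m _ _) (n≤1+n _)) (xs⊆ys++xs _ _) S) hψ)
transfer (∃' v φ) {N} {M} {ρ} {σ} S (a , a≤N , h) =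
  let b , b≤M , m = extend (m^n>0 2 (size φ)) S₂ cmin∈ cmax∈ z≤n a≤N
  in b , b≤M , transfer φ (Similar-assign {v = v} S₂ m) h
  where
  S₂ : Similar (evalT N ρ) (evalT M σ) (2 ^ size φ + 2 ^ size φ) (terms φ)
  S₂ = Similar-halve (size φ) S
transfer (∀' v φ) {N} {M} {ρ} {σ} S f b b≤M =
  let a , a≤N , m = extend (m^n>0 2 (size φ)) (Similar-sym S₂) cmin∈ cmax∈ z≤n b≤M
  in transfer φ (Similar-assign {v = v} S₂ (Matches-sym m)) (f a a≤N)
  where
  S₂ : Similar (evalT N ρ) (evalT M σ) (2 ^ size φ + 2 ^ size φ) (terms φ)
  S₂ = Similar-halve (size φ) S

Similar-ends : ∀ {N M} Is → t ≤ N → t ≤ M →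
               Similar (evalT N (λ _ → 0)) (evalT M (λ _ → 0)) t Is
Similar-ends {t = t} {N = N} {M = M} _ t≤N t≤M .gap {i} {j} _ _ = ends i j
  where
  ends : ∀ i j → evalT N (λ _ → 0) j ∸ evalT N (λ _ → 0) i ≈[ t ]
                 evalT M (λ _ → 0) j ∸ evalT M (λ _ → 0) i
  ends (var _) (var _) = ≈-refl
  ends (var _) cmin    = ≈-refl
  ends (var _) cmax    = inj₂ (t≤N , t≤M)
  ends cmin    (var _) = ≈-refl
  ends cmin    cmin    = ≈-refl
  ends cmin    cmax    = inj₂ (t≤N , t≤M)
  ends cmax    (var _) = ∸≡0-≈ (z≤n {N}) (z≤n {M})
  ends cmax    cmin    = ∸≡0-≈ (z≤n {N}) (z≤n {M})
  ends cmax    cmax    = ∸≡0-≈ (≤-refl {N}) (≤-refl {M})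

⊨-stable : ∀ φ N → 2 ^ size φ ≤ N → (N ⊨ φ) ⇔ ((2 ^ size φ) ⊨ φ)
⊨-stable φ N T≤N = mk⇔ (transfer φ (Similar-ends (terms φ) T≤N ≤-refl))
                       (transfer φ (Similar-ends (terms φ) ≤-refl T≤N))

∃≤? : {P : ℕ → Set} → Decidable P → ∀ N → Dec (Σ ℕ λ a → a ≤ N × P a)
∃≤? P? N with anyUpTo? P? (suc N)
... | yes (a , s≤s a≤N , Pa) = yes (a , a≤N , Pa)
... | no ¬∃ = no λ (a , a≤N , Pa) → ¬∃ (a , s≤s a≤N , Pa)

∀≤? : {P : ℕ → Set} → Decidable P → ∀ N → Dec ((a : ℕ) → a ≤ N → P a)
∀≤? P? N with allUpTo? P? (suc N)
... | yes ∀P = yes λ a a≤N → ∀P (s≤s a≤N)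
... | no ¬∀ = no λ ∀P → ¬∀ λ { {a} (s≤s a≤N) → ∀P a a≤N }

Sat? : ∀ N ρ φ → Dec (Sat N ρ φ)
Sat? N ρ (s ≐ u)    = evalT N ρ s ≟ evalT N ρ u
Sat? N ρ (s ≺ u)    = suc (evalT N ρ s) ≤? evalT N ρ u
Sat? N ρ (succ s u) = suc (evalT N ρ s) ≟ evalT N ρ u
Sat? N ρ (¬' φ)     = ¬? (Sat? N ρ φ)
Sat? N ρ (φ ∧' ψ)   = Sat? N ρ φ ×-dec Sat? N ρ ψ
Sat? N ρ (φ ∨' ψ)   = Sat? N ρ φ ⊎-dec Sat? N ρ ψ
Sat? N ρ (∃' v φ)   = ∃≤? (λ a → Sat? N (update ρ v a) φ) N
Sat? N ρ (∀' v φ)   = ∀≤? (λ a → Sat? N (update ρ v a) φ) N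

3≤size : ∀ φ → 3 ≤ size φ
3≤size (s ≐ u)    = ≤-refl
3≤size (s ≺ u)    = ≤-refl
3≤size (succ s u) = ≤-refl
3≤size (¬' φ)     = ≤-trans (3≤size φ) (n≤1+n _)
3≤size (φ ∧' ψ)   = ≤-trans (3≤size φ) (≤-trans (m≤m+n _ _) (n≤1+n _))
3≤size (φ ∨' ψ)   = ≤-trans (3≤size φ) (≤-trans (m≤m+n _ _) (n≤1+n _))
3≤size (∃' x φ)   = ≤-trans (3≤size φ) (n≤1+n _)
3≤size (∀' x φ)   = ≤-trans (3≤size φ) (n≤1+n _)

-- Two-variable definitions of lengths

other : Fin 2 → Fin 2
other #0        = fsuc #0
other (fsuc #0) = #0

update2-same : ∀ ρ x a → update2 ρ x a x ≡ a
update2-same ρ x a with x Data.Fin.≟ x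
... | yes _  = refl
... | no x≢x = ⊥-elim (x≢x refl)

update2-other : ∀ ρ x a → update2 ρ (other x) a x ≡ ρ x
update2-other ρ #0        a = refl
update2-other ρ (fsuc #0) a = refl

atLeast : ℕ → Fin 2 → FO2
atLeast zero    x = x ≐ x
atLeast (suc k) x = ∃' (other x) ((other x ≺ x) ∧' atLeast k (other x))

atLeast-sat : ∀ k x {N ρ} → ρ x ≤ N → Sat2 N ρ (atLeast k x) ⇔ k ≤ ρ x
atLeast-sat zero    x _ = mk⇔ (λ _ → z≤n) (λ _ → refl)
atLeast-sat (suc k) x {N} {ρ} ρx≤N = mk⇔ ⇒ ⇐
  where
  y = other x

  ⇒ : Sat2 N ρ (atLeast (suc k) x) → suc k ≤ ρ x
  ⇒ (a , a≤N , y<x , h) = ≤-trans (s≤s k≤a) a<ρx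
    where
    ρy≡a = update2-same ρ y a
    a<ρx = subst₂ _<_ ρy≡a (update2-other ρ x a) y<x
    k≤a  = subst (k ≤_) ρy≡a (to (atLeast-sat k y (subst (_≤ N) (sym ρy≡a) a≤N)) h)

  ⇐ : suc k ≤ ρ x → Sat2 N ρ (atLeast (suc k) x)
  ⇐ k<ρx = k , k≤N , subst₂ _<_ (sym ρy≡k) (sym (update2-other ρ x k)) k<ρx ,
           from (atLeast-sat k y (subst (_≤ N) (sym ρy≡k) k≤N)) (≤-reflexive (sym ρy≡k))
    where
    ρy≡k = update2-same ρ y k
    k≤N  = ≤-trans (n≤1+n k) (≤-trans k<ρx ρx≤N)

atLeast-closed : ∀ k x → removeF x (free2 (atLeast k x)) ≡ []
atLeast-closed zero    #0        = refl
atLeast-closed zero    (fsuc #0) = refl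
atLeast-closed (suc k) #0        rewrite atLeast-closed k (fsuc #0) = refl
atLeast-closed (suc k) (fsuc #0) rewrite atLeast-closed k #0 = refl

atLeast-size : ∀ k x → size2 (atLeast k x) ≡ 3 + k * 5
atLeast-size zero    x = refl
atLeast-size (suc k) x rewrite atLeast-size k (other x) = refl

length≥ : ℕ → FO2
length≥ k = ∃' #0 (atLeast k #0)

length≥-sat : ∀ k {N ρ} → Sat2 N ρ (length≥ k) ⇔ k ≤ N
length≥-sat k {N} = mk⇔ (λ (a , a≤N , h) → ≤-trans (to (atLeast-sat k #0 a≤N) h) a≤N)
                        (λ k≤N → N , ≤-refl , from (atLeast-sat k #0 ≤-refl) k≤N)

length≥-size : ∀ k → size2 (length≥ k) ≡ 4 + k * 5
length≥-size k = cong suc (atLeast-size k #0)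

length≡ : ℕ → FO2
length≡ k = length≥ k ∧' (¬' length≥ (suc k))

length≡-sat : ∀ k {N ρ} → Sat2 N ρ (length≡ k) ⇔ N ≡ k
length≡-sat k = mk⇔
  (λ (k≤N , N≱1+k) →
     ≤-antisym (≮⇒≥ (N≱1+k ∘ from (length≥-sat (suc k)))) (to (length≥-sat k) k≤N))
  (λ { refl → from (length≥-sat k) ≤-refl , (λ h → <-irrefl refl (to (length≥-sat (suc k)) h)) })

length≡-closed : ∀ k → IsSentence2 (length≡ k)
length≡-closed k = cong₂ _++_ (atLeast-closed k #0) (atLeast-closed (suc k) #0)

length≡-size : ∀ k → size2 (length≡ k) ≡ 15 + k * 10
length≡-size k rewrite atLeast-size k #0 | atLeast-size (suc k) #0 = sizes k
  where
  sizes : ∀ k → suc (suc (3 + k * 5) + suc (suc (3 + suc k * 5))) ≡ 15 + k * 10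
  sizes = solve-∀

false₂ : FO2
false₂ = ∃' #0 (#0 ≺ #0)

_if_ : {A : Set} → FO2 → Dec A → FO2
ψ if yes _ = ψ
ψ if no _  = false₂

if-sat : ∀ {A N ρ ψ} (A? : Dec A) → Sat2 N ρ (ψ if A?) ⇔ (Sat2 N ρ ψ × A)
if-sat (yes a) = mk⇔ (_, a) proj₁
if-sat (no ¬a) = mk⇔ (λ (_ , _ , x<x) → ⊥-elim (<-irrefl refl x<x)) (λ (_ , a) → ⊥-elim (¬a a))

if-closed : ∀ {A ψ} (A? : Dec A) → IsSentence2 ψ → IsSentence2 (ψ if A?)
if-closed (yes _) closed = closed
if-closed (no _)  _      = refl

if-size : ∀ {A ψ} (A? : Dec A) → 4 ≤ size2 ψ → size2 (ψ if A?) ≤ size2 ψ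
if-size (yes _) _   = ≤-refl
if-size (no _)  4≤ψ = 4≤ψ

module _ {P : ℕ → Set} (P? : Decidable P) (T : ℕ) (stable : ∀ N → T ≤ N → P N ⇔ P T) where

  private
    lengthsUpTo : ℕ → FO2
    lengthsUpTo zero    = length≥ T if P? T
    lengthsUpTo (suc k) = (length≡ k if P? k) ∨' lengthsUpTo k

    sound : ∀ k N → N ⊨₂ lengthsUpTo k → P N
    sound zero N h = from (stable N (to (length≥-sat T) T≤N)) PT
      where
      T≤N = proj₁ (to (if-sat (P? T)) h)
      PT  = proj₂ (to (if-sat (P? T)) h)
    sound (suc k) N (inj₁ h) =
      subst P (sym (to (length≡-sat k) (proj₁ (to (if-sat (P? k)) h)))) (proj₂ (to (if-sat (P? k)) h))
    sound (suc k) N (inj₂ h) = sound k N h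

    complete : ∀ k N → N < k ⊎ T ≤ N → P N → N ⊨₂ lengthsUpTo k
    complete zero    N (inj₂ T≤N) PN =
      from (if-sat (P? T)) (from (length≥-sat T) T≤N , to (stable N T≤N) PN)
    complete (suc k) N (inj₂ T≤N) PN = inj₂ (complete k N (inj₂ T≤N) PN)
    complete (suc k) N (inj₁ N<1+k) PN with m≤n⇒m<n∨m≡n (s≤s⁻¹ N<1+k)
    ... | inj₁ N<k = inj₂ (complete k N (inj₁ N<k) PN)
    ... | inj₂ refl = inj₁ (from (if-sat (P? N)) (from (length≡-sat N) refl , PN))

    closed : ∀ k → IsSentence2 (lengthsUpTo k)
    closed zero    = if-closed (P? T) (atLeast-closed T #0)
    closed (suc k) = cong₂ _++_ (if-closed (P? k) (length≡-closed k)) (closed k)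

    size-bound : ∀ k → k ≤ T → size2 (lengthsUpTo k) ≤ suc k * (16 + T * 10)
    size-bound zero _ = begin
      size2 (length≥ T if P? T) ≤⟨ if-size (P? T) 4≤size ⟩
      size2 (length≥ T)         ≡⟨ length≥-size T ⟩
      4 + T * 5                 ≤⟨ +-mono-≤ (m≤m+n 4 12) (*-monoʳ-≤ T (m≤m+n 5 5)) ⟩
      16 + T * 10               ≡⟨ sym (*-identityˡ _) ⟩
      1 * (16 + T * 10)         ∎
      where
      open ≤-Reasoning
      4≤size = ≤-trans (m≤m+n 4 (T * 5)) (≤-reflexive (sym (length≥-size T)))
    size-bound (suc k) 1+k≤T = +-mono-≤ (s≤s disjunct) (size-bound k k≤T)
      where
      open ≤-Reasoning
      k≤T = ≤-trans (n≤1+n k) 1+k≤T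
      4≤size = ≤-trans (m≤m+n 4 (11 + k * 10)) (≤-reflexive (sym (length≡-size k)))
      disjunct : size2 (length≡ k if P? k) ≤ 15 + T * 10
      disjunct = begin
        size2 (length≡ k if P? k) ≤⟨ if-size (P? k) 4≤size ⟩
        size2 (length≡ k)         ≡⟨ length≡-size k ⟩
        15 + k * 10               ≤⟨ +-monoʳ-≤ 15 (*-monoˡ-≤ 10 k≤T) ⟩
        15 + T * 10               ∎

  ultimatelyConstant-definable :
    Σ FO2 λ ψ → IsSentence2 ψ × size2 ψ ≤ suc T * (16 + T * 10) × ((N : ℕ) → (N ⊨₂ ψ) ⇔ P N)
  ultimatelyConstant-definable =
    lengthsUpTo T , closed T , size-bound T ≤-refl ,
    λ N → mk⇔ (sound T N) (complete T N (<-≤-connex N T))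

[1+2^s]*[16+2^s*10]≤2^[4*s] : ∀ s → 3 ≤ s → suc (2 ^ s) * (16 + 2 ^ s * 10) ≤ 2 ^ (4 * s)
[1+2^s]*[16+2^s*10]≤2^[4*s] s 3≤s = begin
  suc T * (16 + T * 10)      ≤⟨ *-mono-≤ (+-monoˡ-≤ T 1≤T) (+-monoˡ-≤ (T * 10) (*-monoˡ-≤ 2 8≤T)) ⟩
  (T + T) * (T * 2 + T * 10) ≡⟨ expand T ⟩
  24 * (T * T)               ≤⟨ *-monoˡ-≤ (T * T) (≤-trans (m≤m+n 24 40) (*-mono-≤ 8≤T 8≤T)) ⟩
  (T * T) * (T * T)          ≡⟨ square² T ⟩
  T ^ 4                      ≡⟨ ^-*-assoc 2 s 4 ⟩
  2 ^ (s * 4)                ≡⟨ cong (2 ^_) (*-comm s 4) ⟩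
  2 ^ (4 * s)                ∎
  where
  open ≤-Reasoning
  T = 2 ^ s
  8≤T : 8 ≤ T
  8≤T = ^-monoʳ-≤ 2 3≤s
  1≤T : 1 ≤ T
  1≤T = ≤-trans (s≤s z≤n) 8≤T
  expand : ∀ T → (T + T) * (T * 2 + T * 10) ≡ 24 * (T * T)
  expand = solve-∀
  square² : ∀ T → (T * T) * (T * T) ≡ T * (T * (T * (T * 1)))
  square² = solve-∀

lemma5p1 : Σ ℕ λ c → (φ : FO) → IsSentence φ →
    Σ FO2 λ ψ → IsSentence2 ψ × size2 ψ ≤ 2 ^ (c * size φ) ×
      ((N : ℕ) → (N ⊨₂ ψ) ⇔ (N ⊨ φ))
lemma5p1 = 4 , λ φ _ →
  let ψ , closed , size≤ , correct =
        ultimatelyConstant-definable (λ N → Sat? N (λ _ → 0) φ) (2 ^ size φ) (⊨-stable φ)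
  in ψ , closed , ≤-trans size≤ ([1+2^s]*[16+2^s*10]≤2^[4*s] (size φ) (3≤size φ)) , correct
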